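{- Let $G=(X,Y,E,\Sigma,\Pi)$ be a satisfiable game and let $\psi_\mathsf{s},\psi_\mathsf{t}$ be two satisfying labelings of $G$. Then for every positive integer $\rho$, $$\mathrm{val}_{G^{\otimes\rho}}\bigl(\psi_\mathsf{s}^{\otimes\rho}\leftrightsquigarrow\psi_\mathsf{t}^{\otimes\rho}\bigr)\ \ge\ \mathrm{val}_G(\psi_\mathsf{s}\leftrightsquigarrow\psi_\mathsf{t}).$$
   Context: A game is $G=(X,Y,E,\Sigma,\Pi)$ where $(X\cup Y,E)$ is a finite bipartite graph with bipartition $(X,Y)$, $\Sigma$ a finite alphabet, and $\Pi=(\pi_e)_{e\in E}$ with $\pi_{(x,y)}\subseteq\Sigma\times\Sigma$ the admissible pairs (value of $x$, value of $y$). A labeling $\psi\colon X\cup Y\to\Sigma$ satisfies edge $(x,y)$ if $(\psi(x),\psi(y))\in\pi_{(x,y)}$; it satisfies $G$ if it satisfies all edges; $G$ is satisfiable if such a labeling exists. $\mathrm{val}_G(\psi)$ is the fraction of edges satisfied by $\psi$. A reconfiguration sequence from $\psi_\mathsf{s}$ to $\psi_\mathsf{t}$ is a sequence of labelings starting at $\psi_\mathsf{s}$, ending at $\psi_\mathsf{t}$, with consecutive labelings differing in exactly one vertex; its value is the minimum of $\mathrm{val}_G$ over its labelings, and $\mathrm{val}_G(\psi_\mathsf{s}\leftrightsquigarrow\psi_\mathsf{t})$ is the maximum value over all reconfiguration sequences from $\psi_\mathsf{s}$ to $\psi_\mathsf{t}$. The product of games $G_1=(X_1,Y_1,E_1,\Sigma_1,\Pi_1)$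 and $G_2=(X_2,Y_2,E_2,\Sigma_2,\Pi_2)$ is the game $G_1\otimes G_2=(X_1\times X_2,\,Y_1\times Y_2,\,E,\,\Sigma_1\times\Sigma_2,\,\Pi)$ with $E=\{((x_1,x_2),(y_1,y_2)) : (x_1,y_1)\in E_1,(x_2,y_2)\in E_2\}$ and, for $e=((x_1,x_2),(y_1,y_2))$, $\pi_e=\{((\alpha_1,\alpha_2),(\beta_1,\beta_2)) : (\alpha_1,\beta_1)\in\pi_{1,(x_1,y_1)},(\alpha_2,\beta_2)\in\pi_{2,(x_2,y_2)}\}$. $G^{\otimes\rho}$ is the $\rho$-fold product $G\otimes\cdots\otimes G$. For labelings $\psi_1$ of $G_1$ and $\psi_2$ of $G_2$, the product labeling $\psi_1\otimes\psi_2$ of $G_1\otimes G_2$ is $(v_1,v_2)\mapsto(\psi_1(v_1),\psi_2(v_2))$, and $\psi^{\otimes\rho}$ is the $\rho$-fold product $\psi\otimes\cdots\otimes\psi$. -}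

module Defs where

open import Data.Bool using (Bool; true; false; _∧_; if_then_else_)
open import Data.Nat using (ℕ; zero; suc; _+_; NonZero)
open import Data.Fin using (Fin)
open import Data.Fin.Properties using (*↔×)
open import Data.List using (List; map; allFin; concatMap)
open import Data.Nat.ListAction using (sum)
open import Data.Product using (_×_; _,_; ∃; ∃-syntax)
open import Data.Sum using (_⊎_; inj₁; inj₂)
open import Data.Integer using (+_)
open import Data.Rational using (ℚ; 1ℚ; _/_; _⊓_)
open import Function.Bundles using (_↔_; Inverse)
open import Function.Properties.Inverse using (↔-trans; ↔-sym)
open import Data.Product.Function.NonDependent.Propositional using (_×-↔_)
open import Relation.Binary.PropositionalEquality using (_≡_; _≢_)

-- X, Y (vertex sides) and A (the alphabet Σ) are
-- finite: each comes with a bijection to some Fin n.  The edge set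
-- E ⊆ X × Y and each constraint π_(x,y) ⊆ Σ × Σ are given by their
-- (decidable) characteristic functions; π x y is only relevant when
-- (x , y) ∈ E.
record Game : Set₁ where
  field
    X Y A      : Set
    nX nY nA   : ℕ
    finX       : X ↔ Fin nX
    finY       : Y ↔ Fin nY
    finA       : A ↔ Fin nA
    E          : X → Y → Bool
    π          : X → Y → A → A → Bool

open Game public

Vertex : Game → Set
Vertex G = X G ⊎ Y G

Labeling : Game → Set
Labeling G = Vertex G → A G

satEdge : (G : Game) → Labeling G → X G → Y G → Bool
satEdge G ψ x y = π G x y (ψ (inj₁ x)) (ψ (inj₂ y))

Satisfies : (G : Game) → Labeling G → Set
Satisfies G ψ = ∀ x y → E G x y ≡ true → satEdge G ψ x y ≡ true

Satisfiable : Game → Set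
Satisfiable G = ∃[ ψ ] Satisfies G ψ

elemsX : (G : Game) → List (X G)
elemsX G = map (Inverse.from (finX G)) (allFin (nX G))

elemsY : (G : Game) → List (Y G)
elemsY G = map (Inverse.from (finY G)) (allFin (nY G))

countPairs : (G : Game) → (X G → Y G → Bool) → ℕ
countPairs G p =
  sum (concatMap (λ x → map (λ y → if p x y then 1 else 0) (elemsY G)) (elemsX G))

numEdges : Game → ℕ
numEdges G = countPairs G (E G)

numSat : (G : Game) → Labeling G → ℕ
numSat G ψ = countPairs G (λ x y → E G x y ∧ satEdge G ψ x y)

-- val_G(ψ): fraction of edges satisfied (convention: 1 if E = ∅)
valLab : (G : Game) → Labeling G → ℚ
valLab G ψ with numEdges G
... | zero  = 1ℚ
... | suc m = (+ numSat G ψ) / suc m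

OneStep : (G : Game) → Labeling G → Labeling G → Set
OneStep G ψ ψ' =
  ∃[ v ] (ψ v ≢ ψ' v × (∀ w → w ≢ v → ψ w ≡ ψ' w))

-- Reconfiguration sequence from ψs to ψt.  The labelings of the sequence are
-- the left indices of the constructors; it starts at ψs itself and its last
-- labeling agrees with ψt at every vertex.
data ReconfSeq (G : Game) : Labeling G → Labeling G → Set where
  done : ∀ {ψ ψt} → (∀ v → ψ v ≡ ψt v) → ReconfSeq G ψ ψt
  step : ∀ {ψ ψ' ψt} → OneStep G ψ ψ' → ReconfSeq G ψ' ψt → ReconfSeq G ψ ψt

valSeq : (G : Game) → ∀ {ψs ψt} → ReconfSeq G ψs ψt → ℚ
valSeq G (done {ψ} _)   = valLab G ψ
valSeq G (step {ψ} _ s) = valLab G ψ ⊓ valSeq G s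

_⊗_ : Game → Game → Game
G₁ ⊗ G₂ = record
  { X = X G₁ × X G₂
  ; Y = Y G₁ × Y G₂
  ; A = A G₁ × A G₂
  ; nX = nX G₁ Data.Nat.* nX G₂
  ; nY = nY G₁ Data.Nat.* nY G₂
  ; nA = nA G₁ Data.Nat.* nA G₂
  ; finX = ↔-trans (finX G₁ ×-↔ finX G₂) (↔-sym *↔×)
  ; finY = ↔-trans (finY G₁ ×-↔ finY G₂) (↔-sym *↔×)
  ; finA = ↔-trans (finA G₁ ×-↔ finA G₂) (↔-sym *↔×)
  ; E = λ { (x₁ , x₂) (y₁ , y₂) → E G₁ x₁ y₁ ∧ E G₂ x₂ y₂ }
  ; π = λ { (x₁ , x₂) (y₁ , y₂) (α₁ , α₂) (β₁ , β₂) →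
            π G₁ x₁ y₁ α₁ β₁ ∧ π G₂ x₂ y₂ α₂ β₂ }
  }

_⊗L_ : ∀ {G₁ G₂} → Labeling G₁ → Labeling G₂ → Labeling (G₁ ⊗ G₂)
(ψ₁ ⊗L ψ₂) (inj₁ (x₁ , x₂)) = ψ₁ (inj₁ x₁) , ψ₂ (inj₁ x₂)
(ψ₁ ⊗L ψ₂) (inj₂ (y₁ , y₂)) = ψ₁ (inj₂ y₁) , ψ₂ (inj₂ y₂)

_^⊗_ : Game → (ρ : ℕ) → .{{NonZero ρ}} → Game
G ^⊗ suc zero    = G
G ^⊗ suc (suc k) = (G ^⊗ suc k) ⊗ G

_^⊗L_ : ∀ {G} → Labeling G → (ρ : ℕ) → .{{_ : NonZero ρ}} → Labeling (G ^⊗ ρ)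
ψ ^⊗L suc zero    = ψ
_^⊗L_ {G} ψ (suc (suc k)) = _⊗L_ {G ^⊗ suc k} {G} (ψ ^⊗L suc k) ψ

-- Induct on ρ, writing G^⊗(ρ+1) = G^⊗ρ ⊗ G.  In a product H ⊗ G, a sequence in
-- one factor is lifted with the other coordinate frozen at a satisfying labeling,
-- and the two lifts are concatenated.  A single step φ → φ′ at a vertex v of G is
-- lifted by switching the copies of v over the vertices of H one at a time.  Over
-- every H-edge the copy of G then carries φ or φ′ (they differ on one side of the
-- bipartition only), and the frozen labeling satisfies all H-edges, so H ⊗ G has
-- at least |E_H| · min(#sat φ, #sat φ′) satisfied edges out of |E_H| · |E_G|.
-- Lifting along the left factor reduces to the right one through the
-- value-preserving coordinate swap H ⊗ G ≅ G ⊗ H.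
module Submission where

open import Defs
open import Data.Nat using (ℕ; NonZero)
open import Data.Product using (∃)
open import Data.Rational using (_≤_)

open import Data.Bool using (Bool; true; false; _∧_; _∨_; if_then_else_)
open import Data.Bool.Properties using (∧-comm)
open import Data.Fin using (Fin; zero; suc; _↑ˡ_; _↑ʳ_; combine)
open import Data.Fin.Properties using (remQuot-combine; *↔×) renaming (_≟_ to _≟ᶠ_)
import Data.Integer as ℤ
import Data.Integer.Properties as ℤ
open import Data.List using (List; []; _∷_; map; tabulate; concatMap; allFin) renaming (_++_ to _++ˡ_)
open import Data.List.Membership.Propositional using (_∈_)
open import Data.List.Membership.Propositional.Properties using (∈-map⁺; ∈-++⁺ˡ; ∈-++⁺ʳ; ∈-allFin)
open import Data.List.Properties using (map-tabulate)
open import Data.Nat as ℕ using (zero; suc; _+_; _*_; z≤n)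
import Data.Nat.Properties as ℕ
open import Data.Nat.ListAction using (sum)
open import Data.Nat.ListAction.Properties using (sum-++)
open import Data.Product using (_×_; _,_; proj₁; proj₂; swap)
open import Data.Product.Function.NonDependent.Propositional using (_×-↔_)
open import Data.Rational using (ℚ; 1ℚ; _/_; _⊓_)
import Data.Rational.Properties as ℚ
open import Data.Rational.Properties using (toℚᵘ-cancel-≤; toℚᵘ-fromℚᵘ)
open import Data.Rational.Unnormalised as ℚᵘ using (mkℚᵘ; *≤*)
import Data.Rational.Unnormalised.Properties as ℚᵘ
open import Data.Sum as Sum using (_⊎_; inj₁; inj₂)
open import Data.Sum.Properties using (≡-dec)
open import Function using (_∘_)
open import Function.Bundles using (Inverse; _↔_)
open import Function.Properties.Inverse using (↔-trans; ↔-sym; ↔⇒↣)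
open import Relation.Binary.Definitions using (DecidableEquality)
open import Relation.Binary.PropositionalEquality
open import Relation.Nullary using (Dec; yes; no)
open import Relation.Nullary.Decidable using (via-injection; does; dec-true; dec-false)

open import Algebra.Properties.Semiring.Sum ℕ.+-*-semiring
  using (sum-syntax; ∑-comm; sum-cong-≗; *-distribˡ-sum; *-distribʳ-sum)

∑-mono-≤ : ∀ {n} {f g : Fin n → ℕ} → (∀ i → f i ℕ.≤ g i) → ∑[ i < n ] f i ℕ.≤ ∑[ i < n ] g i
∑-mono-≤ {zero}  f≤g = z≤n
∑-mono-≤ {suc n} f≤g = ℕ.+-mono-≤ (f≤g zero) (∑-mono-≤ (f≤g ∘ suc))

∑-↑ : ∀ m {n} (f : Fin (m + n) → ℕ) →
      ∑[ k < m + n ] f k ≡ ∑[ i < m ] f (i ↑ˡ n) + ∑[ j < n ] f (m ↑ʳ j)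
∑-↑ zero    f = refl
∑-↑ (suc m) f = trans (cong (f zero +_) (∑-↑ m (f ∘ suc))) (sym (ℕ.+-assoc (f zero) _ _))

∑-combine : ∀ m {n} (f : Fin (m * n) → ℕ) →
            ∑[ k < m * n ] f k ≡ ∑[ i < m ] ∑[ j < n ] f (combine i j)
∑-combine zero    f = refl
∑-combine (suc m) {n} f =
  trans (∑-↑ n f) (cong (∑[ j < n ] f (j ↑ˡ m * n) +_) (∑-combine m (f ∘ (n ↑ʳ_))))

sum-tabulate : ∀ {n} (f : Fin n → ℕ) → sum (tabulate f) ≡ ∑[ i < n ] f i
sum-tabulate {zero}  f = refl
sum-tabulate {suc n} f = cong (f zero +_) (sum-tabulate (f ∘ suc))

sum-concatMap-tabulate : ∀ {A : Set} {n} (g : A → List ℕ) (f : Fin n → A) →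
                         sum (concatMap g (tabulate f)) ≡ ∑[ i < n ] sum (g (f i))
sum-concatMap-tabulate {n = zero}  g f = refl
sum-concatMap-tabulate {n = suc n} g f =
  trans (sum-++ (g (f zero)) _) (cong (sum (g (f zero)) +_) (sum-concatMap-tabulate g (f ∘ suc)))

𝟙 : Bool → ℕ
𝟙 b = if b then 1 else 0

enumX : (G : Game) → Fin (nX G) → X G
enumX G = Inverse.from (finX G)

enumY : (G : Game) → Fin (nY G) → Y G
enumY G = Inverse.from (finY G)

∑XY : (G : Game) → (X G → Y G → ℕ) → ℕ
∑XY G f = ∑[ i < nX G ] ∑[ j < nY G ] f (enumX G i) (enumY G j)

countPairs-∑XY : ∀ G p → countPairs G p ≡ ∑XY G (λ x y → 𝟙 (p x y))
countPairs-∑XY G p = begin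
  countPairs G p
    ≡⟨ cong₂ (λ xs ys → sum (concatMap (λ x → map (λ y → 𝟙 (p x y)) ys) xs))
             (map-tabulate (λ i → i) (enumX G)) (map-tabulate (λ i → i) (enumY G)) ⟩
  sum (concatMap (λ x → map (λ y → 𝟙 (p x y)) (tabulate (enumY G))) (tabulate (enumX G)))
    ≡⟨ sum-concatMap-tabulate _ (enumX G) ⟩
  ∑[ i < nX G ] sum (map (λ y → 𝟙 (p (enumX G i) y)) (tabulate (enumY G)))
    ≡⟨ sum-cong-≗ (λ i → trans (cong sum (map-tabulate (enumY G) (𝟙 ∘ p (enumX G i))))
                                (sum-tabulate (𝟙 ∘ p (enumX G i) ∘ enumY G))) ⟩
  ∑XY G (λ x y → 𝟙 (p x y)) ∎
  where open ≡-Reasoning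

module _ (G : Game) {f g : X G → Y G → ℕ} where

  ∑XY-cong : (∀ x y → f x y ≡ g x y) → ∑XY G f ≡ ∑XY G g
  ∑XY-cong f≡g = sum-cong-≗ (λ i → sum-cong-≗ {nY G} (λ j → f≡g (enumX G i) _))

  ∑XY-mono-≤ : (∀ x y → f x y ℕ.≤ g x y) → ∑XY G f ℕ.≤ ∑XY G g
  ∑XY-mono-≤ f≤g = ∑-mono-≤ (λ i → ∑-mono-≤ {nY G} (λ j → f≤g (enumX G i) _))

∑XY-*ˡ : ∀ G c (f : X G → Y G → ℕ) → ∑XY G (λ x y → c * f x y) ≡ c * ∑XY G f
∑XY-*ˡ G c f = sym (trans (*-distribˡ-sum c (λ i → ∑[ j < nY G ] f (enumX G i) (enumY G j)))
                          (sum-cong-≗ (λ i → *-distribˡ-sum c (f (enumX G i) ∘ enumY G))))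

∑XY-*ʳ : ∀ G c (f : X G → Y G → ℕ) → ∑XY G (λ x y → f x y * c) ≡ ∑XY G f * c
∑XY-*ʳ G c f = sym (trans (*-distribʳ-sum c (λ i → ∑[ j < nY G ] f (enumX G i) (enumY G j)))
                          (sum-cong-≗ (λ i → *-distribʳ-sum c (f (enumX G i) ∘ enumY G))))

∑-interchange : ∀ {a b c d} (F : Fin a → Fin b → Fin c → Fin d → ℕ) →
  ∑[ i < a ] ∑[ j < b ] ∑[ k < c ] ∑[ l < d ] F i j k l ≡
  ∑[ k < c ] ∑[ l < d ] ∑[ i < a ] ∑[ j < b ] F i j k l
∑-interchange F = begin
  ∑[ i < _ ] ∑[ j < _ ] ∑[ k < _ ] ∑[ l < _ ] F i j k l
    ≡⟨ sum-cong-≗ (λ i → ∑-comm (λ j k → ∑[ l < _ ] F i j k l)) ⟩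
  ∑[ i < _ ] ∑[ k < _ ] ∑[ j < _ ] ∑[ l < _ ] F i j k l
    ≡⟨ ∑-comm (λ i k → ∑[ j < _ ] ∑[ l < _ ] F i j k l) ⟩
  ∑[ k < _ ] ∑[ i < _ ] ∑[ j < _ ] ∑[ l < _ ] F i j k l
    ≡⟨ sum-cong-≗ (λ k → sum-cong-≗ (λ i → ∑-comm (λ j l → F i j k l))) ⟩
  ∑[ k < _ ] ∑[ i < _ ] ∑[ l < _ ] ∑[ j < _ ] F i j k l
    ≡⟨ sum-cong-≗ (λ k → ∑-comm (λ i l → ∑[ j < _ ] F i j k l)) ⟩
  ∑[ k < _ ] ∑[ l < _ ] ∑[ i < _ ] ∑[ j < _ ] F i j k l ∎
  where open ≡-Reasoning

enum-combine : ∀ {A B : Set} {m n} (a : A ↔ Fin m) (b : B ↔ Fin n) i j →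
  Inverse.from (↔-trans (a ×-↔ b) (↔-sym *↔×)) (combine i j) ≡ (Inverse.from a i , Inverse.from b j)
enum-combine a b i j = cong (λ (i , j) → Inverse.from a i , Inverse.from b j) (remQuot-combine i j)

∑XY-⊗ : ∀ H G f → ∑XY (H ⊗ G) f ≡ ∑XY H (λ x₁ y₁ → ∑XY G (λ x₂ y₂ → f (x₁ , x₂) (y₁ , y₂)))
∑XY-⊗ H G f = begin
  ∑XY (H ⊗ G) f
    ≡⟨ ∑-combine (nX H) (λ k → ∑[ l < nY H * nY G ] f (enumX (H ⊗ G) k) (enumY (H ⊗ G) l)) ⟩
  ∑[ a < nX H ] ∑[ b < nX G ] ∑[ k < nY H * nY G ] f (enumX (H ⊗ G) (combine a b)) (enumY (H ⊗ G) k)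
    ≡⟨ sum-cong-≗ {nX H} (λ a → sum-cong-≗ {nX G} (λ b →
         ∑-combine (nY H) (f (enumX (H ⊗ G) (combine a b)) ∘ enumY (H ⊗ G)))) ⟩
  ∑[ a < nX H ] ∑[ b < nX G ] ∑[ i < nY H ] ∑[ j < nY G ]
    f (enumX (H ⊗ G) (combine a b)) (enumY (H ⊗ G) (combine i j))
    ≡⟨ sum-cong-≗ {nX H} (λ a → sum-cong-≗ {nX G} (λ b →
         sum-cong-≗ {nY H} (λ i → sum-cong-≗ {nY G} (λ j →
           cong₂ f (enum-combine (finX H) (finX G) a b) (enum-combine (finY H) (finY G) i j))))) ⟩
  ∑[ a < nX H ] ∑[ b < nX G ] ∑[ i < nY H ] ∑[ j < nY G ]
    f (enumX H a , enumX G b) (enumY H i , enumY G j)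
    ≡⟨ sum-cong-≗ {nX H} (λ a → ∑-comm {nX G} {nY H} _) ⟩
  ∑XY H (λ x₁ y₁ → ∑XY G (λ x₂ y₂ → f (x₁ , x₂) (y₁ , y₂))) ∎
  where open ≡-Reasoning

∑XY-⊗-swap : ∀ H G f → ∑XY (H ⊗ G) (λ x y → f (swap x) (swap y)) ≡ ∑XY (G ⊗ H) f
∑XY-⊗-swap H G f = begin
  ∑XY (H ⊗ G) (λ x y → f (swap x) (swap y))
    ≡⟨ ∑XY-⊗ H G (λ x y → f (swap x) (swap y)) ⟩
  ∑XY H (λ x₁ y₁ → ∑XY G (λ x₂ y₂ → f (x₂ , x₁) (y₂ , y₁)))
    ≡⟨ ∑-interchange (λ a b c d → f (enumX G c , enumX H a) (enumY G d , enumY H b)) ⟩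
  ∑XY G (λ x₂ y₂ → ∑XY H (λ x₁ y₁ → f (x₂ , x₁) (y₂ , y₁)))
    ≡⟨ ∑XY-⊗ G H f ⟨
  ∑XY (G ⊗ H) f ∎
  where open ≡-Reasoning

𝟙-∧ : ∀ a b → 𝟙 (a ∧ b) ≡ 𝟙 a * 𝟙 b
𝟙-∧ true  b = sym (ℕ.+-identityʳ (𝟙 b))
𝟙-∧ false b = refl

𝟙-∧-≤ : ∀ a b → 𝟙 (a ∧ b) ℕ.≤ 𝟙 a
𝟙-∧-≤ true  true  = ℕ.≤-refl
𝟙-∧-≤ true  false = z≤n
𝟙-∧-≤ false b     = z≤n

countPairs-cong : ∀ G {p q} → (∀ x y → p x y ≡ q x y) → countPairs G p ≡ countPairs G q
countPairs-cong G {p} {q} p≡q = begin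
  countPairs G p            ≡⟨ countPairs-∑XY G p ⟩
  ∑XY G (λ x y → 𝟙 (p x y)) ≡⟨ ∑XY-cong G (λ x y → cong 𝟙 (p≡q x y)) ⟩
  ∑XY G (λ x y → 𝟙 (q x y)) ≡⟨ countPairs-∑XY G q ⟨
  countPairs G q            ∎
  where open ≡-Reasoning

numSat-cong : ∀ G {ψ ψ′} → ψ ≗ ψ′ → numSat G ψ ≡ numSat G ψ′
numSat-cong G ψ≗ψ′ = countPairs-cong G (λ x y →
  cong₂ (λ α β → E G x y ∧ π G x y α β) (ψ≗ψ′ (inj₁ x)) (ψ≗ψ′ (inj₂ y)))

numSat≤numEdges : ∀ G ψ → numSat G ψ ℕ.≤ numEdges G
numSat≤numEdges G ψ = begin
  numSat G ψ
    ≡⟨ countPairs-∑XY G (λ x y → E G x y ∧ satEdge G ψ x y) ⟩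
  ∑XY G (λ x y → 𝟙 (E G x y ∧ satEdge G ψ x y))
    ≤⟨ ∑XY-mono-≤ G (λ x y → 𝟙-∧-≤ (E G x y) (satEdge G ψ x y)) ⟩
  ∑XY G (λ x y → 𝟙 (E G x y))
    ≡⟨ countPairs-∑XY G (E G) ⟨
  numEdges G ∎
  where open ℕ.≤-Reasoning

numEdges-⊗ : ∀ H G → numEdges (H ⊗ G) ≡ numEdges H * numEdges G
numEdges-⊗ H G = begin
  numEdges (H ⊗ G)
    ≡⟨ countPairs-∑XY (H ⊗ G) (E (H ⊗ G)) ⟩
  ∑XY (H ⊗ G) (λ x y → 𝟙 (E (H ⊗ G) x y))
    ≡⟨ ∑XY-⊗ H G (λ x y → 𝟙 (E (H ⊗ G) x y)) ⟩
  ∑XY H (λ x₁ y₁ → ∑XY G (λ x₂ y₂ → 𝟙 (E H x₁ y₁ ∧ E G x₂ y₂)))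
    ≡⟨ ∑XY-cong H (λ x₁ y₁ → fibre x₁ y₁) ⟩
  ∑XY H (λ x₁ y₁ → 𝟙 (E H x₁ y₁) * numEdges G)
    ≡⟨ ∑XY-*ʳ H (numEdges G) (λ x₁ y₁ → 𝟙 (E H x₁ y₁)) ⟩
  ∑XY H (λ x₁ y₁ → 𝟙 (E H x₁ y₁)) * numEdges G
    ≡⟨ cong (_* numEdges G) (countPairs-∑XY H (E H)) ⟨
  numEdges H * numEdges G ∎
  where
  open ≡-Reasoning
  fibre : ∀ x₁ y₁ → ∑XY G (λ x₂ y₂ → 𝟙 (E H x₁ y₁ ∧ E G x₂ y₂)) ≡ 𝟙 (E H x₁ y₁) * numEdges G
  fibre x₁ y₁ = begin
    ∑XY G (λ x₂ y₂ → 𝟙 (E H x₁ y₁ ∧ E G x₂ y₂))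
      ≡⟨ ∑XY-cong G (λ x₂ y₂ → 𝟙-∧ (E H x₁ y₁) (E G x₂ y₂)) ⟩
    ∑XY G (λ x₂ y₂ → 𝟙 (E H x₁ y₁) * 𝟙 (E G x₂ y₂))
      ≡⟨ ∑XY-*ˡ G (𝟙 (E H x₁ y₁)) (λ x₂ y₂ → 𝟙 (E G x₂ y₂)) ⟩
    𝟙 (E H x₁ y₁) * ∑XY G (λ x₂ y₂ → 𝟙 (E G x₂ y₂))
      ≡⟨ cong (𝟙 (E H x₁ y₁) *_) (countPairs-∑XY G (E G)) ⟨
    𝟙 (E H x₁ y₁) * numEdges G ∎

countPairs-⊗-swap : ∀ H G p →
  countPairs (H ⊗ G) (λ x y → p (swap x) (swap y)) ≡ countPairs (G ⊗ H) p
countPairs-⊗-swap H G p = begin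
  countPairs (H ⊗ G) (λ x y → p (swap x) (swap y))
    ≡⟨ countPairs-∑XY (H ⊗ G) (λ x y → p (swap x) (swap y)) ⟩
  ∑XY (H ⊗ G) (λ x y → 𝟙 (p (swap x) (swap y)))
    ≡⟨ ∑XY-⊗-swap H G (λ x y → 𝟙 (p x y)) ⟩
  ∑XY (G ⊗ H) (λ x y → 𝟙 (p x y))
    ≡⟨ countPairs-∑XY (G ⊗ H) p ⟨
  countPairs (G ⊗ H) p ∎
  where open ≡-Reasoning

ratio : ℕ → ℕ → ℚ
ratio a zero    = 1ℚ
ratio a (suc m) = ℤ.+ a / suc m

valLab≡ratio : ∀ G ψ → valLab G ψ ≡ ratio (numSat G ψ) (numEdges G)
valLab≡ratio G ψ with numEdges G
... | zero  = refl
... | suc m = refl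

valLab-cong : ∀ G {ψ ψ′} → ψ ≗ ψ′ → valLab G ψ ≡ valLab G ψ′
valLab-cong G {ψ} {ψ′} ψ≗ψ′ = begin
  valLab G ψ                               ≡⟨ valLab≡ratio G ψ ⟩
  ratio (numSat G ψ) (numEdges G)          ≡⟨ cong (λ n → ratio n (numEdges G)) (numSat-cong G ψ≗ψ′) ⟩
  ratio (numSat G ψ′) (numEdges G)         ≡⟨ valLab≡ratio G ψ′ ⟨
  valLab G ψ′                              ∎
  where open ≡-Reasoning

ratio-cross-≤ : ∀ a b c d → a * suc d ℕ.≤ c * suc b → ratio a (suc b) ≤ ratio c (suc d)
ratio-cross-≤ a b c d ad≤cb = toℚᵘ-cancel-≤
  (ℚᵘ.≤-respʳ-≃ (ℚᵘ.≃-sym (toℚᵘ-fromℚᵘ (mkℚᵘ (ℤ.+ c) d)))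
  (ℚᵘ.≤-respˡ-≃ (ℚᵘ.≃-sym (toℚᵘ-fromℚᵘ (mkℚᵘ (ℤ.+ a) b)))
  (*≤* (subst₂ ℤ._≤_ (ℤ.pos-* a (suc d)) (ℤ.pos-* c (suc b)) (ℤ.+≤+ ad≤cb)))))

-- N ≤ e is only needed for k = 0, where the right-hand side is the junk value ratio _ 0 = 1.
ratio-≤ : ∀ {N e k M} → N ℕ.≤ e → k * N ℕ.≤ M → ratio N e ≤ ratio M (k * e)
ratio-≤ {N} {zero} {k} _ _ rewrite ℕ.*-zeroʳ k = ℚ.≤-refl
ratio-≤ {N} {suc g} {zero} N≤e _ =
  ratio-cross-≤ N g 1 0 (ℕ.≤-trans (ℕ.≤-reflexive (ℕ.*-identityʳ N)) (ℕ.≤-trans N≤e (ℕ.m≤m+n _ 0)))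
ratio-≤ {N} {suc g} {suc h} {M} _ kN≤M = ratio-cross-≤ N g M (g + h * suc g) (begin
  N * (suc h * suc g) ≡⟨ ℕ.*-assoc N (suc h) (suc g) ⟨
  N * suc h * suc g   ≡⟨ cong (_* suc g) (ℕ.*-comm N (suc h)) ⟩
  suc h * N * suc g   ≤⟨ ℕ.*-monoˡ-≤ (suc g) kN≤M ⟩
  M * suc g           ∎)
  where open ℕ.≤-Reasoning

Reconf≥ : (G : Game) → ℚ → Labeling G → Labeling G → Set
Reconf≥ G q ψ ψ′ = ∃ λ (S : ReconfSeq G ψ ψ′) → q ≤ valSeq G S

module _ {G : Game} where

  valSeq≤valLab-head : ∀ {ψ ψ′} (S : ReconfSeq G ψ ψ′) → valSeq G S ≤ valLab G ψ
  valSeq≤valLab-head (done _)           = ℚ.≤-refl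
  valSeq≤valLab-head (step {ψ} _ S) = ℚ.p⊓q≤p (valLab G ψ) (valSeq G S)

  startAt : ∀ {ψ ψ′ ψ″} → ψ ≗ ψ′ → ReconfSeq G ψ′ ψ″ → ReconfSeq G ψ ψ″
  startAt ψ≗ψ′ (done ψ′≗ψ″) = done (λ w → trans (ψ≗ψ′ w) (ψ′≗ψ″ w))
  startAt ψ≗ψ′ (step (v , differ , agreeOff) S) =
    step (v , (λ eq → differ (trans (sym (ψ≗ψ′ v)) eq)) , (λ w w≢v → trans (ψ≗ψ′ w) (agreeOff w w≢v))) S

  valSeq-startAt : ∀ {ψ ψ′ ψ″} (ψ≗ψ′ : ψ ≗ ψ′) (S : ReconfSeq G ψ′ ψ″) →
                   valSeq G (startAt ψ≗ψ′ S) ≡ valSeq G S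
  valSeq-startAt ψ≗ψ′ (done _)   = valLab-cong G ψ≗ψ′
  valSeq-startAt ψ≗ψ′ (step _ S) = cong (_⊓ valSeq G S) (valLab-cong G ψ≗ψ′)

  _++_ : ∀ {ψ ψ′ ψ″} → ReconfSeq G ψ ψ′ → ReconfSeq G ψ′ ψ″ → ReconfSeq G ψ ψ″
  done ψ≗ψ′ ++ S′ = startAt ψ≗ψ′ S′
  step s S  ++ S′ = step s (S ++ S′)

  ≤-valSeq-++ : ∀ {q ψ ψ′ ψ″} (S : ReconfSeq G ψ ψ′) (S′ : ReconfSeq G ψ′ ψ″) →
                q ≤ valSeq G S → q ≤ valSeq G S′ → q ≤ valSeq G (S ++ S′)
  ≤-valSeq-++ (done ψ≗ψ′) S′ _ q≤S′ = ℚ.≤-trans q≤S′ (ℚ.≤-reflexive (sym (valSeq-startAt ψ≗ψ′ S′)))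
  ≤-valSeq-++ (step {ψ} _ S) S′ q≤ q≤S′ = ℚ.⊓-glb
    (ℚ.≤-trans q≤ (ℚ.p⊓q≤p (valLab G ψ) (valSeq G S)))
    (≤-valSeq-++ S S′ (ℚ.≤-trans q≤ (ℚ.p⊓q≤q (valLab G ψ) (valSeq G S))) q≤S′)

  module _ {q : ℚ} where

    stay : ∀ {ψ ψ′} → ψ ≗ ψ′ → q ≤ valLab G ψ → Reconf≥ G q ψ ψ′
    stay ψ≗ψ′ q≤ψ = done ψ≗ψ′ , q≤ψ

    atMostOneStep : ∀ {ψ ψ′} → ψ ≗ ψ′ ⊎ OneStep G ψ ψ′ →
                    q ≤ valLab G ψ → q ≤ valLab G ψ′ → Reconf≥ G q ψ ψ′
    atMostOneStep (inj₁ ψ≗ψ′) q≤ψ _    = stay ψ≗ψ′ q≤ψ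
    atMostOneStep (inj₂ s)    q≤ψ q≤ψ′ = step s (done (λ _ → refl)) , ℚ.⊓-glb q≤ψ q≤ψ′

    _++≥_ : ∀ {ψ ψ′ ψ″} → Reconf≥ G q ψ ψ′ → Reconf≥ G q ψ′ ψ″ → Reconf≥ G q ψ ψ″
    (S , q≤S) ++≥ (S′ , q≤S′) = S ++ S′ , ≤-valSeq-++ S S′ q≤S q≤S′

    startAt≥ : ∀ {ψ ψ′ ψ″} → ψ ≗ ψ′ → Reconf≥ G q ψ′ ψ″ → Reconf≥ G q ψ ψ″
    startAt≥ ψ≗ψ′ (S , q≤S) = startAt ψ≗ψ′ S , ℚ.≤-trans q≤S (ℚ.≤-reflexive (sym (valSeq-startAt ψ≗ψ′ S)))

  weaken : ∀ {q q′ ψ ψ′} → q′ ≤ q → Reconf≥ G q ψ ψ′ → Reconf≥ G q′ ψ ψ′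
  weaken q′≤q (S , q≤S) = S , ℚ.≤-trans q′≤q q≤S

glue : (G : Game) → Labeling G → Labeling G → Labeling G
glue G ψ ψ′ (inj₁ x) = ψ (inj₁ x)
glue G ψ ψ′ (inj₂ y) = ψ′ (inj₂ y)

-- ψ and ψ′ differ on one side of the bipartition only.
glue-agreeOff : ∀ G {ψ ψ′} v → (∀ w → w ≢ v → ψ w ≡ ψ′ w) → glue G ψ ψ′ ≗ ψ ⊎ glue G ψ ψ′ ≗ ψ′
glue-agreeOff G (inj₁ _) agreeOff = inj₁ λ { (inj₁ _) → refl ; (inj₂ y) → sym (agreeOff (inj₂ y) λ ()) }
glue-agreeOff G (inj₂ _) agreeOff = inj₂ λ { (inj₁ x) → agreeOff (inj₁ x) (λ ()) ; (inj₂ _) → refl }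

module Fibred (H G : Game) where

  split : Vertex (H ⊗ G) → Vertex H × Vertex G
  split (inj₁ (x₁ , x₂)) = inj₁ x₁ , inj₁ x₂
  split (inj₂ (y₁ , y₂)) = inj₂ y₁ , inj₂ y₂

  split-injective : ∀ {w w′} → split w ≡ split w′ → w ≡ w′
  split-injective {inj₁ _} {inj₁ _} refl = refl
  split-injective {inj₂ _} {inj₂ _} refl = refl
  split-injective {inj₁ _} {inj₂ _} ()
  split-injective {inj₂ _} {inj₁ _} ()

  split? : ∀ u v → Dec (∃ λ w → split w ≡ (u , v))
  split? (inj₁ x₁) (inj₁ x₂) = yes (inj₁ (x₁ , x₂) , refl)
  split? (inj₂ y₁) (inj₂ y₂) = yes (inj₂ (y₁ , y₂) , refl)
  split? (inj₁ _)  (inj₂ _)  = no λ { (inj₁ _ , ()) ; (inj₂ _ , ()) }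
  split? (inj₂ _)  (inj₁ _)  = no λ { (inj₁ _ , ()) ; (inj₂ _ , ()) }

  fibered : Labeling H → (Vertex H → Labeling G) → Labeling (H ⊗ G)
  fibered χ θ w = χ (proj₁ (split w)) , θ (proj₁ (split w)) (proj₂ (split w))

  fibered-const : ∀ χ ψ → fibered χ (λ _ → ψ) ≗ _⊗L_ {H} {G} χ ψ
  fibered-const χ ψ (inj₁ _) = refl
  fibered-const χ ψ (inj₂ _) = refl

  slice : (Vertex H → Labeling G) → X H → Y H → Labeling G
  slice θ x₁ y₁ = glue G (θ (inj₁ x₁)) (θ (inj₂ y₁))

  fibered-change : ∀ {χ θ θ′} u v → (∀ u′ v′ → (u′ , v′) ≢ (u , v) → θ u′ v′ ≡ θ′ u′ v′) →
    θ u v ≢ θ′ u v → fibered χ θ ≗ fibered χ θ′ ⊎ OneStep (H ⊗ G) (fibered χ θ) (fibered χ θ′)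
  fibered-change {χ} {θ} {θ′} u v agree differ with split? u v
  ... | no ∄w = inj₁ λ w → cong (χ (proj₁ (split w)) ,_) (agree _ _ λ eq → ∄w (w , eq))
  ... | yes (w₀ , split-w₀) = inj₂ (w₀ , differ′ , agreeOff)
    where
    differ′ : fibered χ θ w₀ ≢ fibered χ θ′ w₀
    differ′ eq = differ (subst (λ (u , v) → θ u v ≡ θ′ u v) split-w₀ (cong proj₂ eq))
    agreeOff : ∀ w → w ≢ w₀ → fibered χ θ w ≡ fibered χ θ′ w
    agreeOff w w≢w₀ = cong (χ (proj₁ (split w)) ,_)
      (agree _ _ λ eq → w≢w₀ (split-injective (trans eq (sym split-w₀))))

  module _ {χ : Labeling H} (χ-sat : Satisfies H χ) (θ : Vertex H → Labeling G) where

    numSat-fibered : numSat (H ⊗ G) (fibered χ θ) ≡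
                     ∑XY H (λ x₁ y₁ → 𝟙 (E H x₁ y₁) * numSat G (slice θ x₁ y₁))
    numSat-fibered = begin
      numSat (H ⊗ G) (fibered χ θ)
        ≡⟨ countPairs-∑XY (H ⊗ G) (λ x y → E (H ⊗ G) x y ∧ satEdge (H ⊗ G) (fibered χ θ) x y) ⟩
      ∑XY (H ⊗ G) (λ x y → 𝟙 (E (H ⊗ G) x y ∧ satEdge (H ⊗ G) (fibered χ θ) x y))
        ≡⟨ ∑XY-⊗ H G (λ x y → 𝟙 (E (H ⊗ G) x y ∧ satEdge (H ⊗ G) (fibered χ θ) x y)) ⟩
      ∑XY H (λ x₁ y₁ → ∑XY G (λ x₂ y₂ → 𝟙 ((E H x₁ y₁ ∧ E G x₂ y₂) ∧
                                         (satEdge H χ x₁ y₁ ∧ satEdge G (slice θ x₁ y₁) x₂ y₂))))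
        ≡⟨ ∑XY-cong H (λ x₁ y₁ → fibre x₁ y₁) ⟩
      ∑XY H (λ x₁ y₁ → 𝟙 (E H x₁ y₁) * numSat G (slice θ x₁ y₁)) ∎
      where
      open ≡-Reasoning
      guard : ∀ e s b t → (e ≡ true → s ≡ true) → 𝟙 ((e ∧ b) ∧ (s ∧ t)) ≡ 𝟙 e * 𝟙 (b ∧ t)
      guard true  s b t e⇒s rewrite e⇒s refl = sym (ℕ.+-identityʳ (𝟙 (b ∧ t)))
      guard false s b t _ = refl
      fibre : ∀ x₁ y₁ → ∑XY G (λ x₂ y₂ → 𝟙 ((E H x₁ y₁ ∧ E G x₂ y₂) ∧
                          (satEdge H χ x₁ y₁ ∧ satEdge G (slice θ x₁ y₁) x₂ y₂)))
                      ≡ 𝟙 (E H x₁ y₁) * numSat G (slice θ x₁ y₁)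
      fibre x₁ y₁ = begin
        _ ≡⟨ ∑XY-cong G (λ x₂ y₂ → guard e (satEdge H χ x₁ y₁) (E G x₂ y₂) (satEdge G ψ x₂ y₂) (χ-sat x₁ y₁)) ⟩
        ∑XY G (λ x₂ y₂ → 𝟙 e * 𝟙 (sat x₂ y₂)) ≡⟨ ∑XY-*ˡ G (𝟙 e) (λ x₂ y₂ → 𝟙 (sat x₂ y₂)) ⟩
        𝟙 e * ∑XY G (λ x₂ y₂ → 𝟙 (sat x₂ y₂)) ≡⟨ cong (𝟙 e *_) (countPairs-∑XY G sat) ⟨
        𝟙 e * numSat G ψ                      ∎
        where
        e = E H x₁ y₁
        ψ = slice θ x₁ y₁
        sat = λ x₂ y₂ → E G x₂ y₂ ∧ satEdge G ψ x₂ y₂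

    numSat-fibered-≥ : ∀ N → (∀ x₁ y₁ → E H x₁ y₁ ≡ true → N ℕ.≤ numSat G (slice θ x₁ y₁)) →
                       numEdges H * N ℕ.≤ numSat (H ⊗ G) (fibered χ θ)
    numSat-fibered-≥ N fibre≥ = begin
      numEdges H * N                                              ≡⟨ cong (_* N) (countPairs-∑XY H (E H)) ⟩
      ∑XY H (λ x₁ y₁ → 𝟙 (E H x₁ y₁)) * N                         ≡⟨ ∑XY-*ʳ H N (λ x₁ y₁ → 𝟙 (E H x₁ y₁)) ⟨
      ∑XY H (λ x₁ y₁ → 𝟙 (E H x₁ y₁) * N)                         ≤⟨ ∑XY-mono-≤ H guarded ⟩
      ∑XY H (λ x₁ y₁ → 𝟙 (E H x₁ y₁) * numSat G (slice θ x₁ y₁)) ≡⟨ numSat-fibered ⟨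
      numSat (H ⊗ G) (fibered χ θ)                                ∎
      where
      open ℕ.≤-Reasoning
      guarded : ∀ x₁ y₁ → 𝟙 (E H x₁ y₁) * N ℕ.≤ 𝟙 (E H x₁ y₁) * numSat G (slice θ x₁ y₁)
      guarded x₁ y₁ with E H x₁ y₁ in e
      ... | true  = ℕ.*-monoʳ-≤ 1 (fibre≥ x₁ y₁ e)
      ... | false = z≤n

    valLab-fibered-≥ : ∀ φ₀ → (∀ x₁ y₁ → E H x₁ y₁ ≡ true → numSat G φ₀ ℕ.≤ numSat G (slice θ x₁ y₁)) →
                       valLab G φ₀ ≤ valLab (H ⊗ G) (fibered χ θ)
    valLab-fibered-≥ φ₀ fibre≥ = begin
      valLab G φ₀                                       ≡⟨ valLab≡ratio G φ₀ ⟩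
      ratio (numSat G φ₀) (numEdges G)                  ≤⟨ ratio-≤ {k = numEdges H} (numSat≤numEdges G φ₀)
                                                                 (numSat-fibered-≥ (numSat G φ₀) fibre≥) ⟩
      ratio (numSat (H ⊗ G) ψ) (numEdges H * numEdges G) ≡⟨ cong (ratio _) (numEdges-⊗ H G) ⟨
      ratio (numSat (H ⊗ G) ψ) (numEdges (H ⊗ G))       ≡⟨ valLab≡ratio (H ⊗ G) ψ ⟨
      valLab (H ⊗ G) ψ                                  ∎
      where
      open ℚ.≤-Reasoning
      ψ = fibered χ θ

_≟V_ : ∀ {G} → DecidableEquality (Vertex G)
_≟V_ {G} = ≡-dec (via-injection (↔⇒↣ (finX G)) _≟ᶠ_) (via-injection (↔⇒↣ (finY G)) _≟ᶠ_)

∈-enumeration : ∀ {A : Set} {n} (f : A ↔ Fin n) a → a ∈ map (Inverse.from f) (allFin n)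
∈-enumeration f a = subst (_∈ map (Inverse.from f) (allFin _)) (Inverse.strictlyInverseʳ f a)
                          (∈-map⁺ (Inverse.from f) (∈-allFin (Inverse.to f a)))

allVertices : (G : Game) → List (Vertex G)
allVertices G = map inj₁ (elemsX G) ++ˡ map inj₂ (elemsY G)

∈-allVertices : ∀ G u → u ∈ allVertices G
∈-allVertices G (inj₁ x) = ∈-++⁺ˡ (∈-map⁺ inj₁ (∈-enumeration (finX G) x))
∈-allVertices G (inj₂ y) = ∈-++⁺ʳ (map inj₁ (elemsX G)) (∈-map⁺ inj₂ (∈-enumeration (finY G) y))

worseOf : ∀ G (φ φ′ : Labeling G) → ∃ λ φ₀ →
  valLab G φ ⊓ valLab G φ′ ≤ valLab G φ₀ × (∀ b → numSat G φ₀ ℕ.≤ numSat G (if b then φ′ else φ))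
worseOf G φ φ′ with ℕ.≤-total (numSat G φ) (numSat G φ′)
... | inj₁ φ≤φ′ = φ  , ℚ.p⊓q≤p (valLab G φ) (valLab G φ′) , λ { false → ℕ.≤-refl ; true → φ≤φ′ }
... | inj₂ φ′≤φ = φ′ , ℚ.p⊓q≤q (valLab G φ) (valLab G φ′) , λ { false → φ′≤φ ; true → ℕ.≤-refl }

module LiftRight (H G : Game) {χ : Labeling H} (χ-sat : Satisfies H χ) where

  open Fibred H G
  _≟_ : DecidableEquality (Vertex H)
  _≟_ = _≟V_ {H}

  open import Data.List.Membership.DecPropositional _≟_ using (_∈?_)

  module _ {φ φ′ : Labeling G} (v : Vertex G) (differ : φ v ≢ φ′ v)
           (agreeOff : ∀ w → w ≢ v → φ w ≡ φ′ w) where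

    pick : Bool → Labeling G
    pick b = if b then φ′ else φ

    pick-agreeOff : ∀ b b′ w → w ≢ v → pick b w ≡ pick b′ w
    pick-agreeOff false false w _   = refl
    pick-agreeOff false true  w w≢v = agreeOff w w≢v
    pick-agreeOff true  false w w≢v = sym (agreeOff w w≢v)
    pick-agreeOff true  true  w _   = refl

    switched : List (Vertex H) → Vertex H → Labeling G
    switched R u = pick (does (u ∈? R))

    hybrid : List (Vertex H) → Labeling (H ⊗ G)
    hybrid R = fibered χ (switched R)

    valLab-hybrid : ∀ R → valLab G φ ⊓ valLab G φ′ ≤ valLab (H ⊗ G) (hybrid R)
    valLab-hybrid R with worseOf G φ φ′
    ... | φ₀ , q≤φ₀ , φ₀≤pick =
      ℚ.≤-trans q≤φ₀ (valLab-fibered-≥ {χ} χ-sat (switched R) φ₀ λ x₁ y₁ _ → fibre≥ x₁ y₁)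
      where
      flag : Vertex H → Bool
      flag u = does (u ∈? R)
      fibre≥ : ∀ x₁ y₁ → numSat G φ₀ ℕ.≤ numSat G (slice (switched R) x₁ y₁)
      fibre≥ x₁ y₁ with glue-agreeOff G v (pick-agreeOff (flag (inj₁ x₁)) (flag (inj₂ y₁)))
      ... | inj₁ glue≗ = ℕ.≤-trans (φ₀≤pick (flag (inj₁ x₁))) (ℕ.≤-reflexive (sym (numSat-cong G glue≗)))
      ... | inj₂ glue≗ = ℕ.≤-trans (φ₀≤pick (flag (inj₂ y₁))) (ℕ.≤-reflexive (sym (numSat-cong G glue≗)))

    hybrid-∷ : ∀ u R → hybrid R ≗ hybrid (u ∷ R) ⊎ OneStep (H ⊗ G) (hybrid R) (hybrid (u ∷ R))
    -- does (z ∈? u ∷ R) computes to does (z ≟ u) ∨ does (z ∈? R).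
    hybrid-∷ u R with u ∈? R
    ... | yes u∈R = inj₁ λ w → cong (λ b → χ (proj₁ (split w)) , pick b (proj₂ (split w)))
                                    (same-flag (proj₁ (split w)))
      where
      same-flag : ∀ z → does (z ∈? R) ≡ does (z ≟ u) ∨ does (z ∈? R)
      same-flag z with z ≟ u
      ... | yes refl = dec-true (u ∈? R) u∈R
      ... | no _     = refl
    ... | no u∉R = fibered-change {χ} {switched R} {switched (u ∷ R)} u v agree differ′
      where
      agree : ∀ u′ v′ → (u′ , v′) ≢ (u , v) →
              pick (does (u′ ∈? R)) v′ ≡ pick (does (u′ ≟ u) ∨ does (u′ ∈? R)) v′
      agree u′ v′ ne with u′ ≟ u
      ... | yes refl = pick-agreeOff _ _ v′ (λ v′≡v → ne (cong (u ,_) v′≡v))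
      ... | no _     = refl
      differ′ : pick (does (u ∈? R)) v ≢ pick (does (u ≟ u) ∨ does (u ∈? R)) v
      differ′ rewrite dec-false (u ∈? R) u∉R | dec-true (u ≟ u) refl = differ

    hybrid-path : ∀ R → Reconf≥ (H ⊗ G) (valLab G φ ⊓ valLab G φ′) (hybrid []) (hybrid R)
    hybrid-path []      = stay (λ _ → refl) (valLab-hybrid [])
    hybrid-path (u ∷ R) =
      hybrid-path R ++≥ atMostOneStep (hybrid-∷ u R) (valLab-hybrid R) (valLab-hybrid (u ∷ R))

    liftStep : Reconf≥ (H ⊗ G) (valLab G φ ⊓ valLab G φ′) (_⊗L_ {H} {G} χ φ) (_⊗L_ {H} {G} χ φ′)
    liftStep = startAt≥ (λ w → sym (fibered-const χ φ w))
      (hybrid-path (allVertices H) ++≥ stay all-switched (valLab-hybrid (allVertices H)))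
      where
      all-switched : hybrid (allVertices H) ≗ _⊗L_ {H} {G} χ φ′
      all-switched w = trans
        (cong (λ b → χ (proj₁ (split w)) , pick b (proj₂ (split w)))
              (dec-true (proj₁ (split w) ∈? allVertices H) (∈-allVertices H _)))
        (fibered-const χ φ′ w)

  liftʳ : ∀ {φ ψ} (S : ReconfSeq G φ ψ) →
          Reconf≥ (H ⊗ G) (valSeq G S) (_⊗L_ {H} {G} χ φ) (_⊗L_ {H} {G} χ ψ)
  -- Every slice of the constant family is φ on each vertex, so the fibre bound is reflexivity.
  liftʳ (done {φ} φ≗ψ) = stay pointwise
    (subst (valLab G φ ≤_) (valLab-cong (H ⊗ G) (fibered-const χ φ))
           (valLab-fibered-≥ {χ} χ-sat (λ _ → φ) φ (λ _ _ _ → ℕ.≤-refl)))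
    where
    pointwise : _⊗L_ {H} {G} χ φ ≗ _⊗L_ {H} {G} χ _
    pointwise (inj₁ (x₁ , x₂)) = cong (χ (inj₁ x₁) ,_) (φ≗ψ (inj₁ x₂))
    pointwise (inj₂ (y₁ , y₂)) = cong (χ (inj₂ y₁) ,_) (φ≗ψ (inj₂ y₂))
  liftʳ (step {φ} {φ′} (v , differ , agreeOff) S) =
    weaken (ℚ.⊓-monoʳ-≤ (valLab G φ) (valSeq≤valLab-head S)) (liftStep v differ agreeOff)
    ++≥ weaken (ℚ.p⊓q≤q (valLab G φ) (valSeq G S)) (liftʳ S)

swapV : ∀ {A B C D : Set} → (A × B) ⊎ (C × D) → (B × A) ⊎ (D × C)
swapV = Sum.map swap swap

swapV-involutive : ∀ {A B C D : Set} (w : (A × B) ⊎ (C × D)) → swapV (swapV w) ≡ w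
swapV-involutive (inj₁ _) = refl
swapV-involutive (inj₂ _) = refl

module Swap (H G : Game) where

  swapL : Labeling (G ⊗ H) → Labeling (H ⊗ G)
  swapL ψ = swap ∘ ψ ∘ swapV

  valLab-swapL : ∀ ψ → valLab (H ⊗ G) (swapL ψ) ≡ valLab (G ⊗ H) ψ
  valLab-swapL ψ = begin
    valLab (H ⊗ G) (swapL ψ)                                  ≡⟨ valLab≡ratio (H ⊗ G) (swapL ψ) ⟩
    ratio (numSat (H ⊗ G) (swapL ψ)) (numEdges (H ⊗ G))       ≡⟨ cong₂ ratio numSat-swapL numEdges-swap ⟩
    ratio (numSat (G ⊗ H) ψ) (numEdges (G ⊗ H))               ≡⟨ valLab≡ratio (G ⊗ H) ψ ⟨
    valLab (G ⊗ H) ψ                                          ∎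
    where
    open ≡-Reasoning
    numEdges-swap : numEdges (H ⊗ G) ≡ numEdges (G ⊗ H)
    numEdges-swap = trans
      (countPairs-cong (H ⊗ G) λ (x₁ , x₂) (y₁ , y₂) → ∧-comm (E H x₁ y₁) (E G x₂ y₂))
      (countPairs-⊗-swap H G (E (G ⊗ H)))
    numSat-swapL : numSat (H ⊗ G) (swapL ψ) ≡ numSat (G ⊗ H) ψ
    numSat-swapL = trans
      (countPairs-cong (H ⊗ G) λ (x₁ , x₂) (y₁ , y₂) →
        let α = ψ (inj₁ (x₂ , x₁)) ; β = ψ (inj₂ (y₂ , y₁)) in
        cong₂ _∧_ (∧-comm (E H x₁ y₁) (E G x₂ y₂))
                  (∧-comm (π H x₁ y₁ (proj₂ α) (proj₂ β)) (π G x₂ y₂ (proj₁ α) (proj₁ β))))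
      (countPairs-⊗-swap H G (λ x y → E (G ⊗ H) x y ∧ satEdge (G ⊗ H) ψ x y))

  OneStep-swapL : ∀ {ψ ψ′} → OneStep (G ⊗ H) ψ ψ′ → OneStep (H ⊗ G) (swapL ψ) (swapL ψ′)
  OneStep-swapL {ψ} {ψ′} (v , differ , agreeOff) = swapV v , differ′ , agreeOff′
    where
    differ′ : swapL ψ (swapV v) ≢ swapL ψ′ (swapV v)
    differ′ eq = differ (subst (λ w → ψ w ≡ ψ′ w) (swapV-involutive v) (cong swap eq))
    agreeOff′ : ∀ w → w ≢ swapV v → swapL ψ w ≡ swapL ψ′ w
    agreeOff′ w w≢ = cong swap (agreeOff (swapV w) λ eq →
      w≢ (trans (sym (swapV-involutive w)) (cong swapV eq)))

  swapSeq : ∀ {ψ ψ′ ψ″} → swapL ψ′ ≗ ψ″ → ReconfSeq (G ⊗ H) ψ ψ′ → ReconfSeq (H ⊗ G) (swapL ψ) ψ″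
  swapSeq end (done ψ≗ψ′) = done λ w → trans (cong swap (ψ≗ψ′ (swapV w))) (end w)
  swapSeq end (step s S)  = step (OneStep-swapL s) (swapSeq end S)

  valSeq-swapSeq : ∀ {ψ ψ′ ψ″} (end : swapL ψ′ ≗ ψ″) (S : ReconfSeq (G ⊗ H) ψ ψ′) →
                   valSeq (H ⊗ G) (swapSeq end S) ≡ valSeq (G ⊗ H) S
  valSeq-swapSeq end (done {ψ} _)   = valLab-swapL ψ
  valSeq-swapSeq end (step {ψ} _ S) = cong₂ _⊓_ (valLab-swapL ψ) (valSeq-swapSeq end S)

  swap≥ : ∀ {q ψ ψ′ ψ″} → swapL ψ′ ≗ ψ″ → Reconf≥ (G ⊗ H) q ψ ψ′ → Reconf≥ (H ⊗ G) q (swapL ψ) ψ″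
  swap≥ end (S , q≤S) = swapSeq end S , ℚ.≤-trans q≤S (ℚ.≤-reflexive (sym (valSeq-swapSeq end S)))

liftˡ : ∀ H G {χ : Labeling G} → Satisfies G χ → ∀ {φ ψ} (S : ReconfSeq H φ ψ) →
        Reconf≥ (H ⊗ G) (valSeq H S) (_⊗L_ {H} {G} φ χ) (_⊗L_ {H} {G} ψ χ)
liftˡ H G {χ} χ-sat S =
  startAt≥ swapped (swap≥ (λ w → sym (swapped w)) (LiftRight.liftʳ G H {χ} χ-sat S))
  where
  open Swap H G
  swapped : ∀ {φ ψ} → _⊗L_ {H} {G} φ ψ ≗ swapL (_⊗L_ {G} {H} ψ φ)
  swapped (inj₁ _) = refl
  swapped (inj₂ _) = refl

Satisfies-⊗ : ∀ H G {χ ψ} → Satisfies H χ → Satisfies G ψ →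
              Satisfies (H ⊗ G) (_⊗L_ {H} {G} χ ψ)
Satisfies-⊗ H G χ-sat ψ-sat (x₁ , x₂) (y₁ , y₂) e with E H x₁ y₁ in e₁
... | true rewrite χ-sat x₁ y₁ e₁ = ψ-sat x₂ y₂ e

Satisfies-^⊗ : ∀ G {ψ} → Satisfies G ψ → (ρ : ℕ) → .{{_ : NonZero ρ}} →
               Satisfies (G ^⊗ ρ) (ψ ^⊗L ρ)
Satisfies-^⊗ G ψ-sat (suc zero)    = ψ-sat
Satisfies-^⊗ G {ψ} ψ-sat (suc (suc k)) =
  Satisfies-⊗ (G ^⊗ suc k) G {ψ ^⊗L suc k} {ψ} (Satisfies-^⊗ G ψ-sat (suc k)) ψ-sat

reconf-⊗ : ∀ H G {φ φ′ ψ ψ′} → Satisfies H φ′ → Satisfies G ψ →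
  (T : ReconfSeq H φ φ′) (S : ReconfSeq G ψ ψ′) →
  Reconf≥ (H ⊗ G) (valSeq H T ⊓ valSeq G S) (_⊗L_ {H} {G} φ ψ) (_⊗L_ {H} {G} φ′ ψ′)
reconf-⊗ H G {φ′ = φ′} φ′-sat ψ-sat T S =
  weaken (ℚ.p⊓q≤p (valSeq H T) (valSeq G S)) (liftˡ H G ψ-sat T)
  ++≥ weaken (ℚ.p⊓q≤q (valSeq H T) (valSeq G S)) (LiftRight.liftʳ H G {φ′} φ′-sat S)

-- The hypothesis Satisfiable G is unused: ψs already witnesses it.
mainTheorem4 : (G : Game) → Satisfiable G →
    (ψs ψt : Labeling G) → Satisfies G ψs → Satisfies G ψt →
    (ρ : ℕ) → .{{_ : NonZero ρ}} →
    (S : ReconfSeq G ψs ψt) →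
    ∃ λ (S′ : ReconfSeq (G ^⊗ ρ) (ψs ^⊗L ρ) (ψt ^⊗L ρ)) →
      valSeq G S ≤ valSeq (G ^⊗ ρ) S′
mainTheorem4 G _ ψs ψt ψs-sat ψt-sat (suc zero) S = S , ℚ.≤-refl
mainTheorem4 G G-sat ψs ψt ψs-sat ψt-sat (suc (suc k)) S
  with T , S≤T ← mainTheorem4 G G-sat ψs ψt ψs-sat ψt-sat (suc k) S =
  weaken (ℚ.⊓-glb S≤T ℚ.≤-refl)
         (reconf-⊗ (G ^⊗ suc k) G (Satisfies-^⊗ G ψt-sat (suc k)) ψs-sat T S)
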